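{- Let $H$ be a square-free graph. Let $k>0$ and let $P=v_0\dots v_k$ be a path in $H$ with $\deg_H(v_j)$ odd for all $j\in\{1,\dots,k-1\}$. Let $\Omega_y\subseteq\Gamma_H(v_0)$ and $\Omega_z\subseteq\Gamma_H(v_k)$ with $i=v_1\in\Omega_y$ and $s=v_{k-1}\in\Omega_z$. Then for each $o\in\Omega_y\setminus\{i\}$ and each $x\in\Omega_z\setminus\{s\}$: (1) $|\mathrm{Hom}((J_P,y,z),(H,o,x))|=0$; (2) $|\mathrm{Hom}((J_P,y,z),(H,o,s))|=1$; (3) $|\mathrm{Hom}((J_P,y,z),(H,i,x))|=1$; (4) $|\mathrm{Hom}((J_P,y,z),(H,i,s))|$ is odd.
   Context: Graphs are finite, simple, undirected, loopless; paths do not repeat vertices; $\Gamma_H(v)$ is the set of neighbours of $v$. A graph is square-free if it contains no 4-cycle as a subgraph. A partially $H$-labelled graph $J=(G,\tau)$ is a graph $G$ with a partial function $\tau:V(G)\to V(H)$; $\mathrm{Hom}((J,y,z),(H,a,b))$ is the set of graph homomorphisms $\sigma:G\to H$ with $\sigma(v)=\tau(v)$ for $v\in\mathrm{dom}(\tau)$, $\sigma(y)=a$, $\sigma(z)=b$. For a path $P=v_0\dots v_k$ in $H$ with $k\ge1$, the caterpillar gadget $J_P=(G,\tau)$ has $V(G)=\{u_1,\dots,u_{k-1},w_1,\dots,w_{k-1},y,z\}$, where $G$ consists of the path $y u_1\dots u_{k-1} z$ together with the edges $(u_j,w_j)$ for $1\le j\le k-1$, and $\tau=\{w_j\mapsto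 v_j: 1\le j\le k-1\}$ (so for $k=1$, $G$ is the single edge $(y,z)$ and $\tau=\emptyset$). -}

module Defs where

open import Data.Bool using (Bool; true; false; not; _∧_; _∨_; T; if_then_else_)
open import Data.Bool.Properties using (∨-comm)
open import Data.Nat using (ℕ; zero; suc; _+_; _*_; _∸_; _≡ᵇ_; _≤ᵇ_; _<_; _≤_)
open import Data.Nat.DivMod using (_%_; _/_)
open import Data.Fin using (Fin; toℕ) renaming (zero to fzero; suc to fsuc)
open import Data.Fin.Properties using (all?) renaming (_≟_ to _≟ᶠ_)
open import Data.Vec using (Vec; lookup; []; _∷_)
open import Data.List using (List; []; _∷_; _++_; map; upTo; length; filter; concatMap)
open import Data.Bool.ListAction using (any)
open import Data.Maybe using (Maybe; just; nothing)
open import Data.Product using (Σ; ∃; _×_; _,_; proj₁; proj₂)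
open import Data.Unit using (⊤)
open import Relation.Nullary using (¬_; Dec; yes; no)
open import Relation.Nullary.Decidable using (_×-dec_; _→-dec_)
open import Relation.Nullary.Decidable using (T?)
open import Relation.Binary.PropositionalEquality using (_≡_; _≢_; refl; cong; cong₂)

record Graph : Set where
  field
    n      : ℕ
    adj    : Fin n → Fin n → Bool
    sym    : ∀ u v → adj u v ≡ adj v u
    irrefl : ∀ v → adj v v ≡ false

open Graph public

Vertex : Graph → Set
Vertex G = Fin (n G)

Adj : (G : Graph) → Vertex G → Vertex G → Set
Adj G u v = T (adj G u v)

Nbr : (G : Graph) → Vertex G → Vertex G → Set
Nbr G v u = Adj G v u

deg : (G : Graph) → Vertex G → ℕ
deg G v = length (filter (λ u → T? (adj G v u)) (Data.List.allFin (n G)))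
  where import Data.List

Odd : ℕ → Set
Odd m = m % 2 ≡ 1

SquareFree : Graph → Set
SquareFree G = ¬ (Σ (Vertex G) λ a → Σ (Vertex G) λ b → Σ (Vertex G) λ c → Σ (Vertex G) λ d →
  Adj G a b × Adj G b c × Adj G c d × Adj G d a × a ≢ c × b ≢ d)

-- P = v 0 … v k is a path in H (values of v beyond k are irrelevant):
-- consecutive vertices adjacent and no vertex repeated.
IsPath : (H : Graph) → ℕ → (ℕ → Vertex H) → Set
IsPath H k v = (∀ j → j < k → Adj H (v j) (v (suc j)))
             × (∀ j l → j ≤ k → l ≤ k → v j ≡ v l → j ≡ l)

record PLGraph (H : Graph) : Set where
  field
    G   : Graph
    τ   : Vertex G → Maybe (Vertex H)

open PLGraph public

Agrees : {A : Set} → Maybe A → A → Set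
Agrees nothing  _ = ⊤
Agrees (just h) x = x ≡ h

agrees? : {A : Set} → ((x y : A) → Dec (x ≡ y)) → (m : Maybe A) → (x : A) → Dec (Agrees m x)
agrees? _  nothing  _ = yes Data.Unit.tt
agrees? eq (just h) x = eq x h

IsHom : (H : Graph) (J : PLGraph H) (y z : Vertex (G J)) (a b : Vertex H)
        → Vec (Vertex H) (n (G J)) → Set
IsHom H J y z a b σ =
    (∀ u v → Adj (G J) u v → Adj H (lookup σ u) (lookup σ v))
  × (∀ v → Agrees (τ J v) (lookup σ v))
  × lookup σ y ≡ a
  × lookup σ z ≡ b

isHom? : (H : Graph) (J : PLGraph H) (y z : Vertex (G J)) (a b : Vertex H)
         → (σ : Vec (Vertex H) (n (G J))) → Dec (IsHom H J y z a b σ)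
isHom? H J y z a b σ =
  all? (λ u → all? (λ v → T? (adj (G J) u v) →-dec T? (adj H (lookup σ u) (lookup σ v))))
  ×-dec all? (λ v → agrees? _≟ᶠ_ (τ J v) (lookup σ v))
  ×-dec (lookup σ y ≟ᶠ a)
  ×-dec (lookup σ z ≟ᶠ b)

allVecs : (m k : ℕ) → List (Vec (Fin k) m)
allVecs zero    k = [] ∷ []
allVecs (suc m) k = concatMap (λ x → map (x ∷_) (allVecs m k)) (Data.List.allFin k)
  where import Data.List

numHom : (H : Graph) (J : PLGraph H) (y z : Vertex (G J)) (a b : Vertex H) → ℕ
numHom H J y z a b = length (filter (isHom? H J y z a b) (allVecs (n (G J)) (n H)))

-- The caterpillar gadget J_P for P = v 0 … v k.
-- Vertex numbering (2k vertices, k ≥ 1):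
--   y ↦ 0,  z ↦ 1,  u_j ↦ 2j,  w_j ↦ 2j+1   (1 ≤ j ≤ k-1).

gsize : ℕ → ℕ
gsize k = suc (suc (2 * (k ∸ 1)))

innerIdx : ℕ → List ℕ
innerIdx k = map suc (upTo (k ∸ 1))

spine : ℕ → List ℕ
spine k = 0 ∷ (map (λ j → 2 * j) (innerIdx k) ++ (1 ∷ []))

consec : List ℕ → List (ℕ × ℕ)
consec (a ∷ b ∷ r) = (a , b) ∷ consec (b ∷ r)
consec _           = []

gEdges : ℕ → List (ℕ × ℕ)
gEdges k = consec (spine k) ++ map (λ j → (2 * j , suc (2 * j))) (innerIdx k)

matchE : ℕ → ℕ → ℕ × ℕ → Bool
matchE a b e = ((proj₁ e ≡ᵇ a) ∧ (proj₂ e ≡ᵇ b)) ∨ ((proj₁ e ≡ᵇ b) ∧ (proj₂ e ≡ᵇ a))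

gAdjℕ : ℕ → ℕ → ℕ → Bool
gAdjℕ k a b = not (a ≡ᵇ b) ∧ any (matchE a b) (gEdges k)

≡ᵇ-sym : ∀ a b → (a ≡ᵇ b) ≡ (b ≡ᵇ a)
≡ᵇ-sym zero    zero    = refl
≡ᵇ-sym zero    (suc b) = refl
≡ᵇ-sym (suc a) zero    = refl
≡ᵇ-sym (suc a) (suc b) = ≡ᵇ-sym a b

≡ᵇ-refl : ∀ a → (a ≡ᵇ a) ≡ true
≡ᵇ-refl zero    = refl
≡ᵇ-refl (suc a) = ≡ᵇ-refl a

matchE-sym : ∀ a b e → matchE a b e ≡ matchE b a e
matchE-sym a b e = ∨-comm ((proj₁ e ≡ᵇ a) ∧ (proj₂ e ≡ᵇ b)) ((proj₁ e ≡ᵇ b) ∧ (proj₂ e ≡ᵇ a))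

any-sym : ∀ a b (es : List (ℕ × ℕ)) → any (matchE a b) es ≡ any (matchE b a) es
any-sym a b []       = refl
any-sym a b (e ∷ es) = cong₂ _∨_ (matchE-sym a b e) (any-sym a b es)

gAdjℕ-sym : ∀ k a b → gAdjℕ k a b ≡ gAdjℕ k b a
gAdjℕ-sym k a b = cong₂ _∧_ (cong not (≡ᵇ-sym a b)) (any-sym a b (gEdges k))

gAdjℕ-irrefl : ∀ k a → gAdjℕ k a a ≡ false
gAdjℕ-irrefl k a rewrite ≡ᵇ-refl a = refl

gadgetGraph : ℕ → Graph
gadgetGraph k = record
  { n      = gsize k
  ; adj    = λ a b → gAdjℕ k (toℕ a) (toℕ b)
  ; sym    = λ a b → gAdjℕ-sym k (toℕ a) (toℕ b)
  ; irrefl = λ a → gAdjℕ-irrefl k (toℕ a)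
  }

-- τ(w_j) = v_j: vertex number t is w_j iff t is odd and t ≥ 3, j = t / 2
gLabel : (H : Graph) → (ℕ → Vertex H) → ℕ → Maybe (Vertex H)
gLabel H v t = if (t % 2 ≡ᵇ 1) ∧ (3 ≤ᵇ t) then just (v (t / 2)) else nothing

caterpillar : (H : Graph) → (k : ℕ) → (ℕ → Vertex H) → PLGraph H
caterpillar H k v = record
  { G = gadgetGraph k
  ; τ = λ a → gLabel H v (toℕ a)
  }

gy : (k : ℕ) → Fin (gsize k)
gy k = fzero

gz : (k : ℕ) → Fin (gsize k)
gz k = fsuc fzero

module Submission where

open import Defs hiding (sym)
open import Data.Nat using (ℕ; zero; suc; _+_; _*_; _∸_; _<_; _≤_; _≡ᵇ_; z≤n; s≤s)
open import Data.Nat.Properties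
  using (+-0-commutativeMonoid; *-identityˡ; +-identityʳ; +-suc; suc-injective;
         ≡ᵇ⇒≡; ≡⇒≡ᵇ; <⇒≢; <⇒≤; n<1+n; m≤n⇒m≤1+n)
open import Data.Nat.DivMod using (_%_; _/_; m%n<n; %-distribˡ-+; m/n≡1+[m∸n]/n)
open import Data.Nat.Tactic.RingSolver using (solve-∀)
open import Data.Bool using (true; false; T; not)
open import Data.Bool.Properties using (T-∧; T-∨)
open import Data.Bool.ListAction using (any)
open import Data.Fin using (Fin; toℕ; fromℕ<; punchIn)
  renaming (zero to fzero; suc to fsuc; _≟_ to _≟ᶠ_)
open import Data.Fin.Properties using (punchInᵢ≢i; toℕ-fromℕ<; toℕ<n)
open import Data.Fin.Subset using (Subset; _∈_)
open import Data.Vec using (Vec; []; _∷_; lookup)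
open import Data.List
  using (List; []; _∷_; _++_; map; concatMap; tabulate; allFin; length; filter; applyUpTo; upTo)
open import Data.List.Properties
  using (length-++; filter-++; filter-≐; filter-none; filter-accept; map-cong; map-upTo; map-applyUpTo)
open import Data.List.Membership.Propositional using () renaming (_∈_ to _∈ˡ_)
open import Data.List.Relation.Unary.All as All using (All; []; _∷_)
open import Data.List.Relation.Unary.All.Properties using (++⁺; ++⁻)
import Data.List.Relation.Unary.Any as Any
open import Data.List.Relation.Unary.Any.Properties using (any⁺; any⁻)
open import Data.Maybe using (just; nothing)
open import Data.Product using (_×_; _,_; proj₁; proj₂)
open import Data.Sum using (_⊎_; inj₁; inj₂)
open import Data.Unit using (⊤; tt)
open import Data.Empty using (⊥; ⊥-elim)
open import Relation.Nullary using (¬_; Dec; yes; no)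
open import Relation.Nullary.Decidable using (T?; _×-dec_)
open import Relation.Unary using (Pred; Decidable; _≐_)
open import Relation.Binary.PropositionalEquality
open import Function using (_∘_; id; _⇔_; mk⇔; Equivalence)
open import Level using (0ℓ)
open import Algebra.Properties.CommutativeMonoid.Sum +-0-commutativeMonoid
  using (sum; sum-remove; sum-cong-≗; sum-replicate-zero; sum-syntax)

-- A homomorphism of J_P with y ↦ a and z ↦ b is a chain a ~ u₁ ~ ⋯ ~ u_{k-1} ~ b in H with
-- uⱼ ~ vⱼ, the leaf wⱼ being forced to vⱼ. If a ≠ v₁ is a neighbour of v₀, square-freeness makes
-- v₀ the only common neighbour of a and v₁, so u₁ = v₀ and inductively uⱼ = v_{j-1}: there is
-- exactly one chain, and it can only end at s = v_{k-1}. If a = i = v₁, the chains with u₁ = v₂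
-- are those of the same problem for the path v₁ … v_k, while each of the deg(v₁) - 1 other
-- neighbours of v₁ starts one chain to s and none to any other x. As deg(v₁) is odd, the count
-- stays 1 for x ≠ s and odd for s.

private
  variable
    A B X : Set
    L : ℕ

𝟙 : Dec X → ℕ
𝟙 (yes _) = 1
𝟙 (no _)  = 0

𝟙-yes : (d : Dec X) → X → 𝟙 d ≡ 1
𝟙-yes (yes _) _ = refl
𝟙-yes (no ¬x) x = ⊥-elim (¬x x)

𝟙-no : (d : Dec X) → ¬ X → 𝟙 d ≡ 0
𝟙-no (yes x) ¬x = ⊥-elim (¬x x)
𝟙-no (no _)  _  = refl

𝟙*-yes : (d : Dec X) → X → (m : ℕ) → 𝟙 d * m ≡ m
𝟙*-yes d x m = trans (cong (_* m) (𝟙-yes d x)) (*-identityˡ m)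

𝟙*-no : (d : Dec X) → ¬ X → (m : ℕ) → 𝟙 d * m ≡ 0
𝟙*-no d ¬x m = cong (_* m) (𝟙-no d ¬x)

count : {P : Pred A 0ℓ} → Decidable P → List A → ℕ
count P? xs = length (filter P? xs)

count-∷ : {P : Pred A 0ℓ} (P? : Decidable P) (x : A) (xs : List A) →
  count P? (x ∷ xs) ≡ 𝟙 (P? x) + count P? xs
count-∷ P? x xs with P? x
... | yes _ = refl
... | no _  = refl

count-++ : {P : Pred A 0ℓ} (P? : Decidable P) (xs ys : List A) →
  count P? (xs ++ ys) ≡ count P? xs + count P? ys
count-++ P? xs ys = trans (cong length (filter-++ P? xs ys)) (length-++ (filter P? xs))

count-map : {P : Pred A 0ℓ} (P? : Decidable P) (f : B → A) (xs : List B) →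
  count P? (map f xs) ≡ count (λ x → P? (f x)) xs
count-map P? f []       = refl
count-map P? f (x ∷ xs) = begin
  count P? (f x ∷ map f xs)                 ≡⟨ count-∷ P? (f x) (map f xs) ⟩
  𝟙 (P? (f x)) + count P? (map f xs)        ≡⟨ cong (𝟙 (P? (f x)) +_) (count-map P? f xs) ⟩
  𝟙 (P? (f x)) + count (λ y → P? (f y)) xs  ≡⟨ count-∷ (λ y → P? (f y)) x xs ⟨
  count (λ y → P? (f y)) (x ∷ xs)           ∎
  where open ≡-Reasoning

count-tabulate : {P : Pred A 0ℓ} (P? : Decidable P) {n : ℕ} (f : Fin n → A) →
  count P? (tabulate f) ≡ ∑[ i < n ] 𝟙 (P? (f i))
count-tabulate P? {zero}  f = refl
count-tabulate P? {suc n} f =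
  trans (count-∷ P? (f fzero) _) (cong (𝟙 (P? (f fzero)) +_) (count-tabulate P? (f ∘ fsuc)))

count-concatMap-tabulate : {P : Pred A 0ℓ} (P? : Decidable P) {n : ℕ} (g : B → List A) (f : Fin n → B) →
  count P? (concatMap g (tabulate f)) ≡ ∑[ i < n ] count P? (g (f i))
count-concatMap-tabulate P? {zero}  g f = refl
count-concatMap-tabulate P? {suc n} g f =
  trans (count-++ P? (g (f fzero)) _)
        (cong (count P? (g (f fzero)) +_) (count-concatMap-tabulate P? g (f ∘ fsuc)))

count-≐ : {P Q : Pred A 0ℓ} (P? : Decidable P) (Q? : Decidable Q) → P ≐ Q →
  (xs : List A) → count P? xs ≡ count Q? xs
count-≐ P? Q? P≐Q xs = cong length (filter-≐ P? Q? P≐Q xs)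

count-none : {P : Pred A 0ℓ} (P? : Decidable P) → (∀ x → ¬ P x) → (xs : List A) → count P? xs ≡ 0
count-none P? ¬P xs = cong length (filter-none P? (All.universal ¬P xs))

count-singleton : {P : Pred A 0ℓ} (P? : Decidable P) {x : A} → P x → count P? (x ∷ []) ≡ 1
count-singleton P? px = cong length (filter-accept P? px)

∑-pointed : {n : ℕ} (f : Fin n → ℕ) (c : Fin n) → (∀ i → i ≢ c → f i ≡ 0) → ∑[ i < n ] f i ≡ f c
∑-pointed {suc n} f c f≡0 = begin
  sum f                      ≡⟨ sum-remove {i = c} f ⟩
  f c + sum (f ∘ punchIn c)  ≡⟨ cong (f c +_) (sum-cong-≗ (λ i → f≡0 _ (punchInᵢ≢i c i))) ⟩
  f c + ∑[ i < n ] 0         ≡⟨ cong (f c +_) (sum-replicate-zero n) ⟩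
  f c + 0                    ≡⟨ +-identityʳ (f c) ⟩
  f c                        ∎
  where open ≡-Reasoning

∑-exchange : {n : ℕ} (f g : Fin n → ℕ) (c : Fin n) → (∀ i → i ≢ c → f i ≡ g i) →
  ∑[ i < n ] f i + g c ≡ ∑[ i < n ] g i + f c
∑-exchange {suc n} f g c f≡g = begin
  sum f + g c
    ≡⟨ cong (_+ g c) (sum-remove {i = c} f) ⟩
  f c + sum (f ∘ punchIn c) + g c
    ≡⟨ cong (λ s → f c + s + g c) (sum-cong-≗ (λ i → f≡g _ (punchInᵢ≢i c i))) ⟩
  f c + sum (g ∘ punchIn c) + g c
    ≡⟨ +-rotate (f c) _ (g c) ⟩
  g c + sum (g ∘ punchIn c) + f c
    ≡⟨ cong (_+ f c) (sum-remove {i = c} g) ⟨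
  sum g + f c
    ∎
  where
  open ≡-Reasoning
  +-rotate : ∀ a s b → a + s + b ≡ b + s + a
  +-rotate = solve-∀

odd-+-cancel : ∀ x a y b → x + a ≡ y + b → Odd a → Odd b → Odd y → Odd x
odd-+-cancel x a y b eq odd-a odd-b odd-y = residue≡1 (x % 2) (m%n<n x 2) (begin
  (x % 2 + 1) % 2      ≡⟨ cong (λ t → (x % 2 + t) % 2) odd-a ⟨
  (x % 2 + a % 2) % 2  ≡⟨ %-distribˡ-+ x a 2 ⟨
  (x + a) % 2          ≡⟨ cong (_% 2) eq ⟩
  (y + b) % 2          ≡⟨ %-distribˡ-+ y b 2 ⟩
  (y % 2 + b % 2) % 2  ≡⟨ cong₂ (λ s t → (s + t) % 2) odd-y odd-b ⟩
  0                    ∎)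
  where
  open ≡-Reasoning
  residue≡1 : ∀ r → r < 2 → (r + 1) % 2 ≡ 0 → r ≡ 1
  residue≡1 0             _              ()
  residue≡1 1             _              _  = refl
  residue≡1 (suc (suc r)) (s≤s (s≤s ())) _

∑-odd-exchange : {n : ℕ} (f g : Fin n → ℕ) (c : Fin n) → (∀ i → i ≢ c → f i ≡ g i) →
  Odd (f c) → Odd (g c) → Odd (∑[ i < n ] g i) → Odd (∑[ i < n ] f i)
∑-odd-exchange f g c f≡g odd-fc odd-gc =
  odd-+-cancel (sum f) (g c) (sum g) (f c) (∑-exchange f g c f≡g) odd-gc odd-fc

count-allVecs-suc : {n L : ℕ} {P : Pred (Vec (Fin n) (suc L)) 0ℓ} (P? : Decidable P) →
  count P? (allVecs (suc L) n) ≡ ∑[ x < n ] count (λ xs → P? (x ∷ xs)) (allVecs L n)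
count-allVecs-suc {n} {L} P? = begin
  count P? (concatMap (λ x → map (x ∷_) (allVecs L n)) (allFin n))
    ≡⟨ count-concatMap-tabulate P? (λ x → map (x ∷_) (allVecs L n)) id ⟩
  ∑[ x < n ] count P? (map (x ∷_) (allVecs L n))
    ≡⟨ sum-cong-≗ (λ x → count-map P? (x ∷_) (allVecs L n)) ⟩
  ∑[ x < n ] count (λ xs → P? (x ∷ xs)) (allVecs L n)
    ∎
  where open ≡-Reasoning

count-allVecs-head : {n L : ℕ} {P : Pred (Vec (Fin n) (suc L)) 0ℓ} (P? : Decidable P) (c : Fin n) →
  (∀ {x xs} → P (x ∷ xs) → x ≡ c) → count P? (allVecs (suc L) n) ≡ count (λ xs → P? (c ∷ xs)) (allVecs L n)
count-allVecs-head {n} {L} P? c head≡c = trans (count-allVecs-suc P?)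
  (∑-pointed _ c (λ x x≢c → count-none (λ xs → P? (x ∷ xs)) (λ xs p → x≢c (head≡c p)) (allVecs L n)))

double : ℕ → ℕ
double zero    = zero
double (suc m) = suc (suc (double m))

2*≡double : ∀ m → 2 * m ≡ double m
2*≡double zero    = refl
2*≡double (suc m) = cong suc (trans (+-suc m (m + 0)) (cong suc (2*≡double m)))

double-mono-≤ : ∀ {m n} → m ≤ n → double m ≤ double n
double-mono-≤ z≤n       = z≤n
double-mono-≤ (s≤s m≤n) = s≤s (s≤s (double-mono-≤ m≤n))

double-mono-< : ∀ {m n} → m < n → double m < double n
double-mono-< (s≤s m≤n) = s≤s (m≤n⇒m≤1+n (double-mono-≤ m≤n))

double-cancel-≤ : ∀ {m n} → double m ≤ double n → m ≤ n
double-cancel-≤ {zero}          _               = z≤n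
double-cancel-≤ {suc m} {suc n} (s≤s (s≤s m≤n)) = s≤s (double-cancel-≤ m≤n)

double≢1 : ∀ m → double m ≢ 1
double≢1 zero    ()
double≢1 (suc m) ()

double%2≡0 : ∀ m → double m % 2 ≡ 0
double%2≡0 zero    = refl
double%2≡0 (suc m) = double%2≡0 m

suc-double%2≡1 : ∀ m → suc (double m) % 2 ≡ 1
suc-double%2≡1 zero    = refl
suc-double%2≡1 (suc m) = suc-double%2≡1 m

suc-double/2≡ : ∀ m → suc (double m) / 2 ≡ m
suc-double/2≡ zero    = refl
suc-double/2≡ (suc m) =
  trans (m/n≡1+[m∸n]/n {suc (double (suc m))} {2} (s≤s (s≤s z≤n))) (cong suc (suc-double/2≡ m))

data Parity : ℕ → Set where
  even : ∀ i → Parity (double i)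
  odd  : ∀ i → Parity (suc (double i))

parity : ∀ t → Parity t
parity zero = even 0
parity (suc t) with parity t
... | even i = odd i
... | odd  i = even (suc i)

-- Entries past the end of the vector read as the default d.
lookupℕ : A → Vec A L → ℕ → A
lookupℕ d []       _       = d
lookupℕ d (x ∷ _)  zero    = x
lookupℕ d (_ ∷ xs) (suc t) = lookupℕ d xs t

lookup≡lookupℕ : (d : A) (xs : Vec A L) (i : Fin L) → lookup xs i ≡ lookupℕ d xs (toℕ i)
lookup≡lookupℕ d (x ∷ xs) fzero    = refl
lookup≡lookupℕ d (x ∷ xs) (fsuc i) = lookup≡lookupℕ d xs i

leaf<gsize : ∀ {M j} → j ≤ M → suc (double j) < gsize (suc M)
leaf<gsize {M} j≤M = s≤s (s≤s (subst (_ ≤_) (sym (2*≡double M)) (double-mono-≤ j≤M)))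

leaf<gsize⁻¹ : ∀ {M i} → suc (double (suc i)) < gsize (suc M) → i < M
leaf<gsize⁻¹ {M} (s≤s (s≤s i<M)) = double-cancel-≤ (subst (_ ≤_) (2*≡double M) i<M)

leg : ℕ → ℕ × ℕ
leg j = double j , suc (double j)

spineEdges : ℕ → (ℕ → ℕ) → ℕ → List (ℕ × ℕ)
spineEdges x f m = consec (x ∷ (applyUpTo (double ∘ f) m ++ 1 ∷ []))

legEdges : (ℕ → ℕ) → ℕ → List (ℕ × ℕ)
legEdges f m = applyUpTo (leg ∘ f) m

gEdges≡spine++legs : ∀ M → gEdges (suc M) ≡ spineEdges 0 suc M ++ legEdges suc M
gEdges≡spine++legs M = cong₂ _++_
  (cong (λ us → consec (0 ∷ (us ++ 1 ∷ []))) (map-inner 2*≡double))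
  (map-inner (λ j → cong₂ _,_ (2*≡double j) (cong suc (2*≡double j))))
  where
  map-inner : {f g : ℕ → A} → (∀ j → f j ≡ g j) → map f (map suc (upTo M)) ≡ applyUpTo (g ∘ suc) M
  map-inner {g = g} f≗g =
    trans (map-cong f≗g _) (trans (cong (map g) (map-upTo suc M)) (map-applyUpTo suc g M))

ProperEdge : ℕ → ℕ × ℕ → Set
ProperEdge N e = proj₁ e ≢ proj₂ e × proj₁ e < N × proj₂ e < N

spineEdges-proper : ∀ M m x f → (∀ i → f i < f (suc i)) → (∀ i → i < m → f i ≤ M) →
  x < double (f 0) → x ≢ 1 → x < gsize (suc M) → All (ProperEdge (gsize (suc M))) (spineEdges x f m)
spineEdges-proper M zero    x f _ _ _ x≢1 x<N = (x≢1 , x<N , s≤s (s≤s z≤n)) ∷ []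
spineEdges-proper M (suc m) x f increasing bounded x<d x≢1 x<N =
  (<⇒≢ x<d , x<N , d<N) ∷
  spineEdges-proper M m (double (f 0)) (f ∘ suc) (increasing ∘ suc) (λ i i<m → bounded (suc i) (s≤s i<m))
    (double-mono-< (increasing 0)) (double≢1 (f 0)) d<N
  where
  d<N = <⇒≤ (leaf<gsize (bounded 0 (s≤s z≤n)))

legEdges-proper : ∀ M m f → (∀ i → i < m → f i ≤ M) → All (ProperEdge (gsize (suc M))) (legEdges f m)
legEdges-proper M zero    f _       = []
legEdges-proper M (suc m) f bounded =
  (<⇒≢ (n<1+n _) , <⇒≤ w<N , w<N) ∷
  legEdges-proper M m (f ∘ suc) (λ i i<m → bounded (suc i) (s≤s i<m))
  where
  w<N = leaf<gsize (bounded 0 (s≤s z≤n))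

gEdges-proper : ∀ M → All (ProperEdge (gsize (suc M))) (gEdges (suc M))
gEdges-proper M = subst (All _) (sym (gEdges≡spine++legs M))
  (++⁺ (spineEdges-proper M M 0 suc (n<1+n ∘ suc) (λ _ i<M → i<M) (s≤s z≤n) (λ ()) (s≤s z≤n))
       (legEdges-proper M M suc (λ _ i<M → i<M)))

matchE-refl : ∀ p q → T (matchE p q (p , q))
matchE-refl p q = Equivalence.from T-∨ (inj₁ (Equivalence.from T-∧ (≡⇒≡ᵇ p p refl , ≡⇒≡ᵇ q q refl)))

∈⇒any-matchE : ∀ {p q es} → (p , q) ∈ˡ es → T (any (matchE p q) es)
∈⇒any-matchE {p} {q} e∈ = any⁺ (matchE p q) (Any.map (λ { refl → matchE-refl p q }) e∈)

matchE⇒ : ∀ {p q} e → T (matchE p q e) → (proj₁ e ≡ p × proj₂ e ≡ q) ⊎ (proj₁ e ≡ q × proj₂ e ≡ p)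
matchE⇒ {p} {q} (s , t) m with Equivalence.to T-∨ m
... | inj₁ st = let (sp , tq) = Equivalence.to T-∧ st in inj₁ (≡ᵇ⇒≡ s p sp , ≡ᵇ⇒≡ t q tq)
... | inj₂ st = let (sq , tp) = Equivalence.to T-∧ st in inj₂ (≡ᵇ⇒≡ s q sq , ≡ᵇ⇒≡ t p tp)

≢⇒T-not-≡ᵇ : ∀ {p q} → p ≢ q → T (not (p ≡ᵇ q))
≢⇒T-not-≡ᵇ {p} {q} p≢q with p ≡ᵇ q in eq
... | true  = ⊥-elim (p≢q (≡ᵇ⇒≡ p q (subst T (sym eq) tt)))
... | false = tt

module _ (H : Graph) where

  private
    V = Vertex H

  -- Chains in a square-free graph

  Adj-sym : ∀ {a b} → Adj H a b → Adj H b a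
  Adj-sym {a} {b} = subst T (Graph.sym H a b)

  commonNeighbour? : (a c u : V) → Dec (Adj H a u × Adj H u c)
  commonNeighbour? a c u = T? (adj H a u) ×-dec T? (adj H u c)

  squareFree-uniqueCommonNeighbour : SquareFree H → ∀ {a c d u} →
    Adj H a d → Adj H d c → a ≢ c → Adj H a u → Adj H u c → u ≡ d
  squareFree-uniqueCommonNeighbour sqf {a} {c} {d} {u} ad dc a≢c au uc with u ≟ᶠ d
  ... | yes u≡d = u≡d
  ... | no  u≢d = ⊥-elim (sqf (a , u , c , d , au , uc , Adj-sym dc , Adj-sym ad , a≢c , u≢d))

  isPath-tail : ∀ {k v} → IsPath H (suc k) v → IsPath H k (v ∘ suc)
  isPath-tail (edge , inj) =
    (λ j j<k → edge (suc j) (s≤s j<k)) ,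
    (λ j l j≤k l≤k eq → suc-injective (inj (suc j) (suc l) (s≤s j≤k) (s≤s l≤k) eq))

  -- Chain ℓ a b (x₁ ∷ x₁′ ∷ ⋯ ∷ xₘ ∷ xₘ′ ∷ []): y ↦ a, z ↦ b, uⱼ ↦ xⱼ, wⱼ ↦ xⱼ′ is a homomorphism
  -- from the caterpillar with m legs whose leaves are labelled ℓ 0, …, ℓ (m - 1).
  Chain : (ℕ → V) → V → V → Vec V L → Set
  Chain ℓ a b []          = Adj H a b
  Chain ℓ a b (_ ∷ [])    = ⊥
  Chain ℓ a b (u ∷ w ∷ τ) = Adj H a u × Adj H u (ℓ 0) × w ≡ ℓ 0 × Chain (ℓ ∘ suc) u b τ

  chain? : ∀ ℓ a b → Decidable (Chain {L} ℓ a b)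
  chain? ℓ a b []          = T? (adj H a b)
  chain? ℓ a b (_ ∷ [])    = no λ ()
  chain? ℓ a b (u ∷ w ∷ τ) =
    T? (adj H a u) ×-dec T? (adj H u (ℓ 0)) ×-dec w ≟ᶠ ℓ 0 ×-dec chain? (ℓ ∘ suc) u b τ

  #Chains : (ℕ → V) → V → V → ℕ → ℕ
  #Chains ℓ a b L = count (chain? ℓ a b) (allVecs L (n H))

  #Chains-step : ∀ ℓ a b L →
    #Chains ℓ a b (suc (suc L)) ≡ ∑[ u < n H ] (𝟙 (commonNeighbour? a (ℓ 0) u) * #Chains (ℓ ∘ suc) u b L)
  #Chains-step ℓ a b L = begin
    #Chains ℓ a b (suc (suc L))
      ≡⟨ count-allVecs-suc (chain? ℓ a b) ⟩
    ∑[ u < n H ] count (λ τ → chain? ℓ a b (u ∷ τ)) (allVecs (suc L) (n H))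
      ≡⟨ sum-cong-≗ (λ u → count-allVecs-head (λ τ → chain? ℓ a b (u ∷ τ)) (ℓ 0) (proj₁ ∘ proj₂ ∘ proj₂)) ⟩
    ∑[ u < n H ] count (λ τ → chain? ℓ a b (u ∷ ℓ 0 ∷ τ)) (allVecs L (n H))
      ≡⟨ sum-cong-≗ through ⟩
    ∑[ u < n H ] (𝟙 (commonNeighbour? a (ℓ 0) u) * #Chains (ℓ ∘ suc) u b L)
      ∎
    where
    open ≡-Reasoning
    through : ∀ u → count (λ τ → chain? ℓ a b (u ∷ ℓ 0 ∷ τ)) (allVecs L (n H))
                  ≡ 𝟙 (commonNeighbour? a (ℓ 0) u) * #Chains (ℓ ∘ suc) u b L
    through u with commonNeighbour? a (ℓ 0) u
    ... | yes (au , uℓ) =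
      trans (count-≐ (λ τ → chain? ℓ a b (u ∷ ℓ 0 ∷ τ)) (chain? (ℓ ∘ suc) u b)
                     (proj₂ ∘ proj₂ ∘ proj₂ , λ c → au , uℓ , refl , c) (allVecs L (n H)))
            (sym (*-identityˡ _))
    ... | no ¬au×uℓ =
      count-none (λ τ → chain? ℓ a b (u ∷ ℓ 0 ∷ τ)) (λ τ c → ¬au×uℓ (proj₁ c , proj₁ (proj₂ c)))
                 (allVecs L (n H))

  #Chains-forced : ∀ ℓ {a} b d L → (∀ {u} → Adj H a u → Adj H u (ℓ 0) → u ≡ d) →
    Adj H a d → Adj H d (ℓ 0) → #Chains ℓ a b (suc (suc L)) ≡ #Chains (ℓ ∘ suc) d b L
  #Chains-forced ℓ {a} b d L unique ad dℓ = begin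
    #Chains ℓ a b (suc (suc L))
      ≡⟨ #Chains-step ℓ a b L ⟩
    ∑[ u < n H ] (𝟙 (commonNeighbour? a (ℓ 0) u) * #Chains (ℓ ∘ suc) u b L)
      ≡⟨ ∑-pointed _ d (λ u u≢d → 𝟙*-no (commonNeighbour? a (ℓ 0) u) (λ (au , uℓ) → u≢d (unique au uℓ)) _) ⟩
    𝟙 (commonNeighbour? a (ℓ 0) d) * #Chains (ℓ ∘ suc) d b L
      ≡⟨ 𝟙*-yes (commonNeighbour? a (ℓ 0) d) (ad , dℓ) _ ⟩
    #Chains (ℓ ∘ suc) d b L
      ∎
    where open ≡-Reasoning

  module _ (sqf : SquareFree H) where

    #Chains-fromOffPath : ∀ r v → IsPath H (suc r) v → ∀ {a} → Adj H (v 0) a → a ≢ v 1 →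
        (∀ {b} → Adj H (v (suc r)) b → b ≢ v r → #Chains (v ∘ suc) a b (double r) ≡ 0)
      × #Chains (v ∘ suc) a (v r) (double r) ≡ 1
    #Chains-fromOffPath zero v path {a} v₀a a≢v₁ =
      (λ {b} v₁b b≢v₀ → count-none (chain? (v ∘ suc) a b)
                          (λ { [] ab → b≢v₀ (forced ab (Adj-sym v₁b)) }) (allVecs 0 (n H))) ,
      count-singleton (chain? (v ∘ suc) a (v 0)) (Adj-sym v₀a)
      where
      forced : ∀ {u} → Adj H a u → Adj H u (v 1) → u ≡ v 0
      forced = squareFree-uniqueCommonNeighbour sqf (Adj-sym v₀a) (proj₁ path 0 (s≤s z≤n)) a≢v₁
    #Chains-fromOffPath (suc r) v path {a} v₀a a≢v₁ =
      (λ vb b≢ → trans shift (proj₁ ih vb b≢)) , trans shift (proj₂ ih)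
      where
      v₀v₁ : Adj H (v 0) (v 1)
      v₀v₁ = proj₁ path 0 (s≤s z≤n)
      v₀≢v₂ : v 0 ≢ v 2
      v₀≢v₂ eq with proj₂ path 0 2 z≤n (s≤s (s≤s z≤n)) eq
      ... | ()
      ih = #Chains-fromOffPath r (v ∘ suc) (isPath-tail path) (Adj-sym v₀v₁) v₀≢v₂
      shift : ∀ {b} → #Chains (v ∘ suc) a b (double (suc r)) ≡ #Chains (v ∘ suc ∘ suc) (v 0) b (double r)
      shift {b} = #Chains-forced (v ∘ suc) b (v 0) (double r)
        (squareFree-uniqueCommonNeighbour sqf (Adj-sym v₀a) v₀v₁ a≢v₁) (Adj-sym v₀a) v₀v₁

    #Chains-fromPath≡1 : ∀ r v → IsPath H (suc r) v →
      ∀ {b} → Adj H (v (suc r)) b → b ≢ v r → #Chains (v ∘ suc) (v 1) b (double r) ≡ 1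
    #Chains-fromPath≡1 zero    v path {b} v₁b _ = count-singleton (chain? (v ∘ suc) (v 1) b) v₁b
    #Chains-fromPath≡1 (suc r) v path {b} vb b≢ = begin
      #Chains (v ∘ suc) (v 1) b (double (suc r))
        ≡⟨ #Chains-step (v ∘ suc) (v 1) b (double r) ⟩
      ∑[ u < n H ] term u
        ≡⟨ ∑-pointed term (v 2) offPath ⟩
      term (v 2)
        ≡⟨ 𝟙*-yes (commonNeighbour? (v 1) (v 1) (v 2)) (v₁v₂ , Adj-sym v₁v₂) _ ⟩
      #Chains (v ∘ suc ∘ suc) (v 2) b (double r)
        ≡⟨ #Chains-fromPath≡1 r (v ∘ suc) (isPath-tail path) vb b≢ ⟩
      1 ∎
      where
      open ≡-Reasoning
      v₁v₂ : Adj H (v 1) (v 2)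
      v₁v₂ = proj₁ path 1 (s≤s (s≤s z≤n))
      term : V → ℕ
      term u = 𝟙 (commonNeighbour? (v 1) (v 1) u) * #Chains (v ∘ suc ∘ suc) u b (double r)
      offPath : ∀ u → u ≢ v 2 → term u ≡ 0
      offPath u u≢v₂ with commonNeighbour? (v 1) (v 1) u
      ... | yes (v₁u , _) = trans (*-identityˡ _)
                              (proj₁ (#Chains-fromOffPath r (v ∘ suc) (isPath-tail path) v₁u u≢v₂) vb b≢)
      ... | no _          = refl

    #Chains-fromPath-odd : ∀ r v → IsPath H (suc r) v → (∀ j → 1 ≤ j → j < suc r → Odd (deg H (v j))) →
      Odd (#Chains (v ∘ suc) (v 1) (v r) (double r))
    #Chains-fromPath-odd zero v path _ =
      subst Odd (sym (count-singleton (chain? (v ∘ suc) (v 1) (v 0)) (Adj-sym (proj₁ path 0 (s≤s z≤n))))) refl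
    #Chains-fromPath-odd (suc r) v path odd-deg =
      subst Odd (sym (#Chains-step (v ∘ suc) (v 1) (v (suc r)) (double r)))
        (∑-odd-exchange term isNeighbour (v 2) offPath
          (subst Odd (sym (𝟙*-yes (commonNeighbour? (v 1) (v 1) (v 2)) (v₁v₂ , Adj-sym v₁v₂) _))
            (#Chains-fromPath-odd r (v ∘ suc) (isPath-tail path)
              (λ j 1≤j j<r → odd-deg (suc j) (s≤s z≤n) (s≤s j<r))))
          (subst Odd (sym (𝟙-yes (T? (adj H (v 1) (v 2))) v₁v₂)) refl)
          (subst Odd (count-tabulate (λ u → T? (adj H (v 1) u)) id) (odd-deg 1 (s≤s z≤n) (s≤s (s≤s z≤n)))))
      where
      v₁v₂ : Adj H (v 1) (v 2)
      v₁v₂ = proj₁ path 1 (s≤s (s≤s z≤n))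
      term : V → ℕ
      term u = 𝟙 (commonNeighbour? (v 1) (v 1) u) * #Chains (v ∘ suc ∘ suc) u (v (suc r)) (double r)
      isNeighbour : V → ℕ
      isNeighbour u = 𝟙 (T? (adj H (v 1) u))
      -- Each neighbour u ≠ v 2 of v 1 starts exactly one chain, so the sum of the terms can
      -- differ from deg (v 1) only at u = v 2.
      offPath : ∀ u → u ≢ v 2 → term u ≡ isNeighbour u
      offPath u u≢v₂ with T? (adj H (v 1) u)
      ... | yes v₁u = trans (𝟙*-yes (yes v₁u ×-dec T? (adj H u (v 1))) (v₁u , Adj-sym v₁u) _)
                        (proj₂ (#Chains-fromOffPath r (v ∘ suc) (isPath-tail path) v₁u u≢v₂))
      ... | no _    = refl

  -- Homomorphisms of the caterpillar as chains

  Preserves : (ℕ → V) → List (ℕ × ℕ) → Set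
  Preserves g = All (λ e → Adj H (g (proj₁ e)) (g (proj₂ e)))

  preserves-matched : ∀ {g es p q} → Preserves g es → T (any (matchE p q) es) → Adj H (g p) (g q)
  preserves-matched {g} {es} {p} {q} pres m with All.lookupAny pres (any⁻ (matchE p q) es m)
  ... | ge , me with matchE⇒ _ me
  ...   | inj₁ (s≡p , t≡q) = subst₂ (λ s t → Adj H (g s) (g t)) s≡p t≡q ge
  ...   | inj₂ (s≡q , t≡p) = Adj-sym (subst₂ (λ s t → Adj H (g s) (g t)) s≡q t≡p ge)

  Labelled : (ℕ → V) → (ℕ → ℕ) → (ℕ → V) → ℕ → Set
  Labelled g f ℓ zero    = ⊤
  Labelled g f ℓ (suc m) = g (suc (double (f 0))) ≡ ℓ 0 × Labelled g (f ∘ suc) (ℓ ∘ suc) m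

  labelled-lookup : ∀ {g f ℓ} m → Labelled g f ℓ m → ∀ {i} → i < m → g (suc (double (f i))) ≡ ℓ i
  labelled-lookup (suc m) (l₀ , _)  {zero}  _         = l₀
  labelled-lookup (suc m) (_  , ls) {suc i} (s≤s i<m) = labelled-lookup m ls i<m

  labelled-tabulate : ∀ {g f ℓ} m → (∀ i → i < m → g (suc (double (f i))) ≡ ℓ i) → Labelled g f ℓ m
  labelled-tabulate zero    _  = tt
  labelled-tabulate (suc m) ls = ls 0 (s≤s z≤n) , labelled-tabulate m (λ i i<m → ls (suc i) (s≤s i<m))

  -- τ lists the values of g at the vertices u and w of the legs f 0, f 1, …, f (m - 1).
  chain⇔homConditions : ∀ {d} g m f ℓ x (τ : Vec V L) → L ≡ double m →
    (∀ i → lookupℕ d τ (double i) ≡ g (double (f i))) →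
    (∀ i → lookupℕ d τ (suc (double i)) ≡ g (suc (double (f i)))) →
    Chain ℓ (g x) (g 1) τ ⇔ (Preserves g (spineEdges x f m) × Preserves g (legEdges f m) × Labelled g f ℓ m)
  chain⇔homConditions g zero f ℓ x [] refl _ _ =
    mk⇔ (λ gx1 → (gx1 ∷ []) , [] , tt) (λ { ((gx1 ∷ []) , _ , _) → gx1 })
  chain⇔homConditions g (suc m) f ℓ x (u ∷ w ∷ τ) refl uAt wAt with uAt 0 | wAt 0
  ... | refl | refl = mk⇔
    (λ (xu , uℓ , wℓ , c) → let (s , l , lb) = Equivalence.to ih c in
      (xu ∷ s) , (subst (Adj H u) (sym wℓ) uℓ ∷ l) , wℓ , lb)
    (λ { ((xu ∷ s) , (uw ∷ l) , wℓ , lb) →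
      xu , subst (Adj H u) wℓ uw , wℓ , Equivalence.from ih (s , l , lb) })
    where
    ih = chain⇔homConditions g m (f ∘ suc) (ℓ ∘ suc) (double (f 0)) τ refl (uAt ∘ suc) (wAt ∘ suc)

  module _ (v : ℕ → V) (M : ℕ) where

    private
      N = gsize (suc M)

    homOnEdges⇔preserves : (σ : Vec V N) (d : V) →
      (∀ p q → Adj (gadgetGraph (suc M)) p q → Adj H (lookup σ p) (lookup σ q)) ⇔
      Preserves (lookupℕ d σ) (gEdges (suc M))
    homOnEdges⇔preserves σ d = mk⇔
      (λ hom → All.tabulate λ {e} e∈ → edge hom e e∈ (All.lookup (gEdges-proper M) e∈))
      (λ pres p q pq → subst₂ (Adj H) (sym (lookup≡lookupℕ d σ p)) (sym (lookup≡lookupℕ d σ q))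
                         (preserves-matched pres (proj₂ (Equivalence.to T-∧ pq))))
      where
      g = lookupℕ d σ
      lookup-fromℕ< : ∀ {p} (p<N : p < N) → lookup σ (fromℕ< p<N) ≡ g p
      lookup-fromℕ< p<N = trans (lookup≡lookupℕ d σ _) (cong g (toℕ-fromℕ< p<N))
      edge : (∀ p q → Adj (gadgetGraph (suc M)) p q → Adj H (lookup σ p) (lookup σ q)) →
        ∀ e → e ∈ˡ gEdges (suc M) → ProperEdge N e → Adj H (g (proj₁ e)) (g (proj₂ e))
      edge hom (p , q) e∈ (p≢q , p<N , q<N) =
        subst₂ (Adj H) (lookup-fromℕ< p<N) (lookup-fromℕ< q<N) (hom (fromℕ< p<N) (fromℕ< q<N)
          (subst₂ (λ s t → T (gAdjℕ (suc M) s t)) (sym (toℕ-fromℕ< p<N)) (sym (toℕ-fromℕ< q<N))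
            (Equivalence.from T-∧ (≢⇒T-not-≡ᵇ p≢q , ∈⇒any-matchE e∈))))

    gLabel-even : ∀ i → gLabel H v (double i) ≡ nothing
    gLabel-even i rewrite double%2≡0 i = refl

    gLabel-leaf : ∀ i → gLabel H v (suc (double (suc i))) ≡ just (v (suc i))
    gLabel-leaf i rewrite suc-double%2≡1 (suc i) | suc-double/2≡ (suc i) = refl

    labels⇔labelled : (σ : Vec V N) (d : V) →
      (∀ p → Agrees (gLabel H v (toℕ p)) (lookup σ p)) ⇔ Labelled (lookupℕ d σ) suc (v ∘ suc) M
    labels⇔labelled σ d = mk⇔
      (λ lab → labelled-tabulate M λ i i<M → labelAt lab (leaf<gsize i<M))
      (λ lb p → subst (Agrees (gLabel H v (toℕ p))) (sym (lookup≡lookupℕ d σ p))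
                  (agrees lb (toℕ p) (toℕ<n p)))
      where
      g = lookupℕ d σ
      labelAt : (∀ p → Agrees (gLabel H v (toℕ p)) (lookup σ p)) →
        ∀ {i} (t<N : suc (double (suc i)) < N) → g (suc (double (suc i))) ≡ v (suc i)
      labelAt lab {i} t<N =
        trans (sym (trans (lookup≡lookupℕ d σ _) (cong g (toℕ-fromℕ< t<N))))
          (subst (λ l → Agrees l (lookup σ (fromℕ< t<N)))
            (trans (cong (gLabel H v) (toℕ-fromℕ< t<N)) (gLabel-leaf i)) (lab (fromℕ< t<N)))
      agrees : Labelled g suc (v ∘ suc) M → ∀ t → t < N → Agrees (gLabel H v t) (g t)
      agrees lb t t<N with parity t
      ... | even i      = subst (λ l → Agrees l (g (double i))) (sym (gLabel-even i)) tt
      ... | odd zero    = tt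
      ... | odd (suc i) = subst (λ l → Agrees l (g (suc (double (suc i))))) (sym (gLabel-leaf i))
                            (labelled-lookup M lb (leaf<gsize⁻¹ t<N))

    isHom⇔chain : ∀ a b (τ : Vec V (2 * M)) →
      IsHom H (caterpillar H (suc M) v) (gy (suc M)) (gz (suc M)) a b (a ∷ b ∷ τ) ⇔ Chain (v ∘ suc) a b τ
    isHom⇔chain a b τ = mk⇔
      (λ (edges , labels , _ , _) →
        let (spine , legs) = ++⁻ (spineEdges 0 suc M)
              (subst (Preserves g) (gEdges≡spine++legs M) (Equivalence.to (homOnEdges⇔preserves σ a) edges))
        in Equivalence.from conditions (spine , legs , Equivalence.to (labels⇔labelled σ a) labels))
      (λ c → let (spine , legs , labelled) = Equivalence.to conditions c in
        Equivalence.from (homOnEdges⇔preserves σ a)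
          (subst (Preserves g) (sym (gEdges≡spine++legs M)) (++⁺ spine legs)) ,
        Equivalence.from (labels⇔labelled σ a) labelled , refl , refl)
      where
      σ = a ∷ b ∷ τ
      g = lookupℕ a σ
      conditions = chain⇔homConditions g M suc (v ∘ suc) 0 τ (2*≡double M) (λ _ → refl) (λ _ → refl)

    numHom≡#Chains : ∀ a b →
      numHom H (caterpillar H (suc M) v) (gy (suc M)) (gz (suc M)) a b ≡ #Chains (v ∘ suc) a b (double M)
    numHom≡#Chains a b = begin
      count isHom?′ (allVecs N (n H))
        ≡⟨ count-allVecs-head isHom?′ a (proj₁ ∘ proj₂ ∘ proj₂) ⟩
      count (λ σ → isHom?′ (a ∷ σ)) (allVecs (suc (2 * M)) (n H))
        ≡⟨ count-allVecs-head (λ σ → isHom?′ (a ∷ σ)) b (proj₂ ∘ proj₂ ∘ proj₂) ⟩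
      count (λ τ → isHom?′ (a ∷ b ∷ τ)) (allVecs (2 * M) (n H))
        ≡⟨ count-≐ (λ τ → isHom?′ (a ∷ b ∷ τ)) (chain? (v ∘ suc) a b)
             ((λ {τ} → Equivalence.to (isHom⇔chain a b τ)) , (λ {τ} → Equivalence.from (isHom⇔chain a b τ)))
             (allVecs (2 * M) (n H)) ⟩
      #Chains (v ∘ suc) a b (2 * M)
        ≡⟨ cong (#Chains (v ∘ suc) a b) (2*≡double M) ⟩
      #Chains (v ∘ suc) a b (double M)
        ∎
      where
      open ≡-Reasoning
      isHom?′ = isHom? H (caterpillar H (suc M) v) (gy (suc M)) (gz (suc M)) a b

lemma4p5 : (H : Graph) → SquareFree H →
    (k : ℕ) → 0 < k →
    (v : ℕ → Vertex H) → IsPath H k v →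
    (∀ j → 1 ≤ j → j < k → Odd (deg H (v j))) →
    (Ωy Ωz : Subset (n H)) →
    (∀ o → o ∈ Ωy → Nbr H (v 0) o) →
    (∀ x → x ∈ Ωz → Nbr H (v k) x) →
    v 1 ∈ Ωy → v (k ∸ 1) ∈ Ωz →
    ∀ o x → o ∈ Ωy → o ≢ v 1 → x ∈ Ωz → x ≢ v (k ∸ 1) →
      (numHom H (caterpillar H k v) (gy k) (gz k) o x ≡ 0)
    × (numHom H (caterpillar H k v) (gy k) (gz k) o (v (k ∸ 1)) ≡ 1)
    × (numHom H (caterpillar H k v) (gy k) (gz k) (v 1) x ≡ 1)
    × Odd (numHom H (caterpillar H k v) (gy k) (gz k) (v 1) (v (k ∸ 1)))
lemma4p5 H sqf (suc r) _ v path odd-deg Ωy Ωz Ωy⊆Γv₀ Ωz⊆Γvₖ _ _ o x o∈Ωy o≢i x∈Ωz x≢s =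
  trans (numHom≡#Chains H v r o x) (proj₁ fromOffPath (Ωz⊆Γvₖ x x∈Ωz) x≢s) ,
  trans (numHom≡#Chains H v r o (v r)) (proj₂ fromOffPath) ,
  trans (numHom≡#Chains H v r (v 1) x) (#Chains-fromPath≡1 H sqf r v path (Ωz⊆Γvₖ x x∈Ωz) x≢s) ,
  subst Odd (sym (numHom≡#Chains H v r (v 1) (v r))) (#Chains-fromPath-odd H sqf r v path odd-deg)
  where
  fromOffPath = #Chains-fromOffPath H sqf r v path (Ωy⊆Γv₀ o o∈Ωy) o≢i
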